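{- For all $m,n\in\mathbb{N}$, $$\mathrm{Li}^-_{y_m}\mathrm{Li}^-_{y_n}=\sum_{k=0}^m(-1)^k\binom{m}{k}\mathrm{Li}^-_{y_{m-k}y_{n+k}}=\sum_{k=0}^n(-1)^k\binom{n}{k}\mathrm{Li}^-_{y_{n-k}y_{m+k}}.$$
   Context: $\mathbb{N}$ is the set of non-negative integers. For $\mathbf{s}=(s_1,\ldots,s_r)\in\mathbb{N}^r$ put $\mathrm{Li}^-_{\mathbf{s}}(z):=\sum_{n_1>\cdots>n_r>0}n_1^{s_1}\cdots n_r^{s_r}z^{n_1}$ for $|z|<1$; each is a rational function in $\mathbb{Q}[z,(1-z)^{ -1}]$, and products are products of these functions. For a word $y_{s_1}\cdots y_{s_r}$ in letters $y_0,y_1,\ldots$, $\mathrm{Li}^-_{y_{s_1}\cdots y_{s_r}}:=\mathrm{Li}^-_{(s_1,\ldots,s_r)}$. -}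

module Defs where

open import Data.Nat as ℕ using (ℕ; zero; suc; _∸_)
open import Data.Nat.Combinatorics using (_C_)
open import Data.Integer as ℤ using (ℤ; +_; -1ℤ; _+_; _*_; _^_)
open import Data.List using (List; []; _∷_)

-- Formal power series in z with integer coefficients: n ↦ coefficient of z^n.
-- Since each Li⁻ is analytic on |z|<1, equality of functions on the disc is
-- equality of Taylor coefficients; products are Cauchy products.
Series : Set
Series = ℕ → ℤ

Σ≤ : ℕ → (ℕ → ℤ) → ℤ
Σ≤ zero    f = f zero
Σ≤ (suc n) f = Σ≤ n f + f (suc n)

-- H s N = Σ_{N > n₁ > ⋯ > n_r > 0} n₁^{s₁} ⋯ n_r^{s_r}   (H [] N = 1)
H : List ℕ → ℕ → ℕ
H []       N       = 1
H (s ∷ ss) zero    = 0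
H (s ∷ ss) (suc N) = H (s ∷ ss) N ℕ.+ (if0 N)
  where
  if0 : ℕ → ℕ
  if0 zero    = 0
  if0 (suc j) = (suc j) ℕ.^ s ℕ.* H ss (suc j)

-- Li⁻_s(z) = Σ_{n₁>⋯>n_r>0} n₁^{s₁}⋯n_r^{s_r} z^{n₁}, as a coefficient sequence.
Li⁻ : List ℕ → Series
Li⁻ []       zero    = + 1
Li⁻ []       (suc N) = + 0
Li⁻ (s ∷ ss) zero    = + 0
Li⁻ (s ∷ ss) (suc N) = + ((suc N) ℕ.^ s ℕ.* H ss (suc N))

_⋆_ : Series → Series → Series
(f ⋆ g) N = Σ≤ N (λ i → f i * g (N ∸ i))

y : ℕ → ℕ → List ℕ
y a b = a ∷ b ∷ []

-- The coefficient of z^N in Li⁻_{y_b} Li⁻_{y_a} is Σ_{0<j<N} j^b (N − j)^a. Expanding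
-- (N − j)^a = Σ_k (−1)^k C(a,k) N^(a−k) j^k by the binomial theorem and swapping the
-- sums, the factor j^k merges into j^b, and N^(a−k) Σ_{0<j<N} j^(b+k) is the
-- coefficient of z^N in Li⁻_{y_(a−k) y_(b+k)}. The two forms come from a ↔ b and
-- commutativity of the product.
module Submission where

open import Defs
open import Data.Nat as ℕ using (ℕ; zero; suc; _∸_; _≤_; z≤n) renaming (_+_ to _+ℕ_)
import Data.Nat.Properties as ℕ
open import Data.Nat.Combinatorics using (_C_)
open import Data.Integer using (ℤ; +_; -1ℤ; 0ℤ; _+_; _-_; -_; _*_; _^_; _⊖_)
import Data.Integer.Properties as ℤ
open import Data.List using ([]; _∷_)
open import Data.Fin using (toℕ)
open import Data.Product using (_×_; _,_)
open import Algebra.Properties.CommutativeSemigroup ℤ.*-commutativeSemigroup using (x∙yz≈y∙xz)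
import Algebra.Properties.Semiring.Mult ℤ.+-*-semiring as Mult
open import Algebra.Properties.Semiring.Sum ℤ.+-*-semiring using (sum; sum-cong-≋)
import Algebra.Properties.CommutativeSemiring.Binomial ℤ.+-*-commutativeSemiring as Binomial
import Algebra.Properties.CommutativeSemiring.Exp ℤ.+-*-commutativeSemiring as Exp
open import Data.Integer.Solver using (module +-*-Solver)
open import Relation.Binary.PropositionalEquality using (_≡_; refl; sym; trans; cong; cong₂; module ≡-Reasoning)
open ≡-Reasoning

Σ≤-cong : ∀ n {f g : ℕ → ℤ} → (∀ k → k ≤ n → f k ≡ g k) → Σ≤ n f ≡ Σ≤ n g
Σ≤-cong zero    f≡g = f≡g 0 z≤n
Σ≤-cong (suc n) f≡g =
  cong₂ _+_ (Σ≤-cong n (λ k k≤n → f≡g k (ℕ.m≤n⇒m≤1+n k≤n))) (f≡g (suc n) ℕ.≤-refl)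

Σ≤-zero : ∀ n → Σ≤ n (λ _ → 0ℤ) ≡ 0ℤ
Σ≤-zero zero    = refl
Σ≤-zero (suc n) = trans (ℤ.+-identityʳ _) (Σ≤-zero n)

Σ≤-distrib-+ : ∀ n f g → Σ≤ n (λ k → f k + g k) ≡ Σ≤ n f + Σ≤ n g
Σ≤-distrib-+ zero    f g = refl
Σ≤-distrib-+ (suc n) f g = begin
  Σ≤ n (λ k → f k + g k) + (f (suc n) + g (suc n)) ≡⟨ cong (_+ (f (suc n) + g (suc n))) (Σ≤-distrib-+ n f g) ⟩
  (Σ≤ n f + Σ≤ n g) + (f (suc n) + g (suc n))      ≡⟨ +-interchange (Σ≤ n f) (Σ≤ n g) (f (suc n)) (g (suc n)) ⟩
  (Σ≤ n f + f (suc n)) + (Σ≤ n g + g (suc n))      ∎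
  where
  open +-*-Solver
  +-interchange : ∀ a b c d → (a + b) + (c + d) ≡ (a + c) + (b + d)
  +-interchange = solve 4 (λ a b c d → (a :+ b) :+ (c :+ d) := (a :+ c) :+ (b :+ d)) refl

*-distribˡ-Σ≤ : ∀ n c f → c * Σ≤ n f ≡ Σ≤ n (λ k → c * f k)
*-distribˡ-Σ≤ zero    c f = refl
*-distribˡ-Σ≤ (suc n) c f =
  trans (ℤ.*-distribˡ-+ c (Σ≤ n f) (f (suc n))) (cong (_+ c * f (suc n)) (*-distribˡ-Σ≤ n c f))

Σ≤-comm : ∀ m n (g : ℕ → ℕ → ℤ) → Σ≤ m (λ i → Σ≤ n (g i)) ≡ Σ≤ n (λ j → Σ≤ m (λ i → g i j))
Σ≤-comm zero    n g = refl
Σ≤-comm (suc m) n g =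
  trans (cong (_+ Σ≤ n (g (suc m))) (Σ≤-comm m n g)) (sym (Σ≤-distrib-+ n _ (g (suc m))))

Σ≤-suc : ∀ n f → Σ≤ (suc n) f ≡ f 0 + Σ≤ n (λ k → f (suc k))
Σ≤-suc zero    f = refl
Σ≤-suc (suc n) f = trans (cong (_+ f (suc (suc n))) (Σ≤-suc n f)) (ℤ.+-assoc (f 0) _ _)

Σ≤-reverse : ∀ n f → Σ≤ n f ≡ Σ≤ n (λ k → f (n ∸ k))
Σ≤-reverse zero    f = refl
Σ≤-reverse (suc n) f = begin
  Σ≤ n f + f (suc n)                          ≡⟨ cong (_+ f (suc n)) (Σ≤-reverse n f) ⟩
  Σ≤ n (λ k → f (n ∸ k)) + f (suc n)          ≡⟨ ℤ.+-comm (Σ≤ n (λ k → f (n ∸ k))) (f (suc n)) ⟩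
  f (suc n) + Σ≤ n (λ k → f (n ∸ k))          ≡⟨ Σ≤-suc n (λ k → f (suc n ∸ k)) ⟨
  Σ≤ (suc n) (λ k → f (suc n ∸ k))            ∎

Σ≤≡sum : ∀ n f → Σ≤ n f ≡ sum {suc n} (λ k → f (toℕ k))
Σ≤≡sum zero    f = sym (ℤ.+-identityʳ (f 0))
Σ≤≡sum (suc n) f = trans (Σ≤-suc n f) (cong (_+_ (f 0)) (Σ≤≡sum n (λ k → f (suc k))))

×≡* : ∀ n x → n Mult.× x ≡ + n * x
×≡* zero    x = sym (ℤ.*-zeroˡ x)
×≡* (suc n) x = begin
  x + n Mult.× x         ≡⟨ cong (_+_ x) (×≡* n x) ⟩
  x + + n * x       ≡⟨ cong (_+ + n * x) (ℤ.*-identityˡ x) ⟨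
  + 1 * x + + n * x ≡⟨ ℤ.*-distribʳ-+ x (+ 1) (+ n) ⟨
  + suc n * x       ∎

Exp^≡^ : ∀ x n → x Exp.^ n ≡ x ^ n
Exp^≡^ x zero    = refl
Exp^≡^ x (suc n) = cong (x *_) (Exp^≡^ x n)

^-distrib-* : ∀ x y n → (x * y) ^ n ≡ x ^ n * y ^ n
^-distrib-* x y n = begin
  (x * y) ^ n             ≡⟨ Exp^≡^ (x * y) n ⟨
  (x * y) Exp.^ n         ≡⟨ Exp.^-distrib-* x y n ⟩
  x Exp.^ n * y Exp.^ n   ≡⟨ cong₂ _*_ (Exp^≡^ x n) (Exp^≡^ y n) ⟩
  x ^ n * y ^ n           ∎

pos-^ : ∀ m n → + (m ℕ.^ n) ≡ (+ m) ^ n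
pos-^ m zero    = refl
pos-^ m (suc n) = trans (ℤ.pos-* m (m ℕ.^ n)) (cong (+ m *_) (pos-^ m n))

binomial : ∀ a x y → (x + y) ^ a ≡ Σ≤ a (λ k → + (a C k) * (x ^ k * y ^ (a ∸ k)))
binomial a x y = begin
  (x + y) ^ a                      ≡⟨ Exp^≡^ (x + y) a ⟨
  (x + y) Exp.^ a                  ≡⟨ Binomial.theorem a x y ⟩
  Binomial.binomialExpansion x y a ≡⟨ sum-cong-≋ {suc a} (λ k → binomialTerm≡ (toℕ k)) ⟩
  sum {suc a} (λ k → + (a C toℕ k) * (x ^ toℕ k * y ^ (a ∸ toℕ k))) ≡⟨ Σ≤≡sum a _ ⟨
  Σ≤ a (λ k → + (a C k) * (x ^ k * y ^ (a ∸ k)))                   ∎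
  where
  binomialTerm≡ : ∀ k → (a C k) Mult.× (x Exp.^ k * y Exp.^ (a ∸ k)) ≡ + (a C k) * (x ^ k * y ^ (a ∸ k))
  binomialTerm≡ k =
    trans (×≡* (a C k) _) (cong (+ (a C k) *_) (cong₂ _*_ (Exp^≡^ x k) (Exp^≡^ y (a ∸ k))))

binomial-alternating : ∀ a x z → (x - z) ^ a ≡ Σ≤ a (λ k → -1ℤ ^ k * + (a C k) * x ^ (a ∸ k) * z ^ k)
binomial-alternating a x z = begin
  (x - z) ^ a          ≡⟨ cong (_^ a) x-z≡-1*z+x ⟩
  (-1ℤ * z + x) ^ a    ≡⟨ binomial a (-1ℤ * z) x ⟩
  Σ≤ a (λ k → + (a C k) * ((-1ℤ * z) ^ k * x ^ (a ∸ k))) ≡⟨ Σ≤-cong a (λ k _ → alternatingTerm≡ k) ⟩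
  Σ≤ a (λ k → -1ℤ ^ k * + (a C k) * x ^ (a ∸ k) * z ^ k) ∎
  where
  open +-*-Solver
  x-z≡-1*z+x : x - z ≡ -1ℤ * z + x
  x-z≡-1*z+x = trans (ℤ.+-comm x (- z)) (cong (_+ x) (sym (ℤ.-1*i≡-i z)))
  reorder : ∀ c s Z X → c * ((s * Z) * X) ≡ s * c * X * Z
  reorder = solve 4 (λ c s Z X → c :* ((s :* Z) :* X) := s :* c :* X :* Z) refl
  alternatingTerm≡ : ∀ k → + (a C k) * ((-1ℤ * z) ^ k * x ^ (a ∸ k)) ≡ -1ℤ ^ k * + (a C k) * x ^ (a ∸ k) * z ^ k
  alternatingTerm≡ k = trans (cong (λ t → + (a C k) * (t * x ^ (a ∸ k))) (^-distrib-* -1ℤ z k))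
                             (reorder (+ (a C k)) (-1ℤ ^ k) (z ^ k) (x ^ (a ∸ k)))

⋆-comm : ∀ f g N → (f ⋆ g) N ≡ (g ⋆ f) N
⋆-comm f g N = trans (Σ≤-reverse N _) (Σ≤-cong N (λ i i≤N →
  trans (cong (λ j → f (N ∸ i) * g j) (ℕ.m∸[m∸n]≡n i≤N)) (ℤ.*-comm (f (N ∸ i)) (g i))))

Li⁻-[s]-suc : ∀ s j → Li⁻ (s ∷ []) (suc j) ≡ (+ suc j) ^ s
Li⁻-[s]-suc s j = trans (cong +_ (ℕ.*-identityʳ (suc j ℕ.^ s))) (pos-^ (suc j) s)

Li⁻-[s+k] : ∀ s k j → Li⁻ ((s +ℕ k) ∷ []) j ≡ Li⁻ (s ∷ []) j * (+ j) ^ k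
Li⁻-[s+k] s k zero    = sym (ℤ.*-zeroˡ ((+ 0) ^ k))
Li⁻-[s+k] s k (suc j) = begin
  Li⁻ ((s +ℕ k) ∷ []) (suc j)         ≡⟨ Li⁻-[s]-suc (s +ℕ k) j ⟩
  (+ suc j) ^ (s +ℕ k)                ≡⟨ ℤ.^-distribˡ-+-* (+ suc j) s k ⟩
  (+ suc j) ^ s * (+ suc j) ^ k       ≡⟨ cong (_* (+ suc j) ^ k) (Li⁻-[s]-suc s j) ⟨
  Li⁻ (s ∷ []) (suc j) * (+ suc j) ^ k ∎

H[s]≡Σ≤Li⁻ : ∀ s M → + H (s ∷ []) (suc M) ≡ Σ≤ M (Li⁻ (s ∷ []))
H[s]≡Σ≤Li⁻ s zero    = refl
H[s]≡Σ≤Li⁻ s (suc M) =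
  trans (ℤ.pos-+ (H (s ∷ []) (suc M)) _) (cong (_+ Li⁻ (s ∷ []) (suc M)) (H[s]≡Σ≤Li⁻ s M))

Li⁻-y-suc : ∀ p q M → Li⁻ (y p q) (suc M) ≡ (+ suc M) ^ p * Σ≤ M (Li⁻ (q ∷ []))
Li⁻-y-suc p q M = trans (ℤ.pos-* (suc M ℕ.^ p) (H (q ∷ []) (suc M)))
                        (cong₂ _*_ (pos-^ (suc M) p) (H[s]≡Σ≤Li⁻ q M))

⋆-Li⁻-[a]-suc : ∀ f a M → (f ⋆ Li⁻ (a ∷ [])) (suc M) ≡ Σ≤ M (λ j → f j * (+ suc M - + j) ^ a)
⋆-Li⁻-[a]-suc f a M = begin
  Σ≤ M F + F (suc M)                     ≡⟨ cong (_+_ (Σ≤ M F)) last-term≡0 ⟩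
  Σ≤ M F + 0ℤ                            ≡⟨ ℤ.+-identityʳ (Σ≤ M F) ⟩
  Σ≤ M F                                 ≡⟨ Σ≤-cong M (λ j j≤M → cong (f j *_) (Li⁻-[a]-at-difference j j≤M)) ⟩
  Σ≤ M (λ j → f j * (+ suc M - + j) ^ a) ∎
  where
  F : ℕ → ℤ
  F j = f j * Li⁻ (a ∷ []) (suc M ∸ j)
  last-term≡0 : F (suc M) ≡ 0ℤ
  last-term≡0 = trans (cong (λ i → f (suc M) * Li⁻ (a ∷ []) i) (ℕ.n∸n≡0 M)) (ℤ.*-zeroʳ (f (suc M)))
  Li⁻-[a]-at-difference : ∀ j → j ≤ M → Li⁻ (a ∷ []) (suc M ∸ j) ≡ (+ suc M - + j) ^ a
  Li⁻-[a]-at-difference j j≤M = begin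
    Li⁻ (a ∷ []) (suc M ∸ j)   ≡⟨ cong (Li⁻ (a ∷ [])) (ℕ.+-∸-assoc 1 j≤M) ⟩
    Li⁻ (a ∷ []) (suc (M ∸ j)) ≡⟨ Li⁻-[s]-suc a (M ∸ j) ⟩
    (+ suc (M ∸ j)) ^ a        ≡⟨ cong (λ i → (+ i) ^ a) (ℕ.+-∸-assoc 1 j≤M) ⟨
    (+ (suc M ∸ j)) ^ a        ≡⟨ cong (_^ a) (ℤ.⊖-≥ (ℕ.m≤n⇒m≤1+n j≤M)) ⟨
    (suc M ⊖ j) ^ a          ≡⟨ cong (_^ a) (ℤ.[+m]-[+n]≡m⊖n (suc M) j) ⟨
    (+ suc M - + j) ^ a        ∎

Li⁻[b]⋆Li⁻[a]-expansion : ∀ a b N →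
  (Li⁻ (b ∷ []) ⋆ Li⁻ (a ∷ [])) N ≡ Σ≤ a (λ k → -1ℤ ^ k * + (a C k) * Li⁻ (y (a ∸ k) (b +ℕ k)) N)
Li⁻[b]⋆Li⁻[a]-expansion a b zero =
  sym (trans (Σ≤-cong a (λ k _ → ℤ.*-zeroʳ (-1ℤ ^ k * + (a C k)))) (Σ≤-zero a))
Li⁻[b]⋆Li⁻[a]-expansion a b (suc M) = begin
  (Li⁻ (b ∷ []) ⋆ Li⁻ (a ∷ [])) (suc M)
    ≡⟨ ⋆-Li⁻-[a]-suc (Li⁻ (b ∷ [])) a M ⟩
  Σ≤ M (λ j → Li⁻ (b ∷ []) j * (X - + j) ^ a)
    ≡⟨ Σ≤-cong M (λ j _ → cong (Li⁻ (b ∷ []) j *_) (binomial-alternating a X (+ j))) ⟩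
  Σ≤ M (λ j → Li⁻ (b ∷ []) j * Σ≤ a (λ k → c k * (+ j) ^ k))
    ≡⟨ Σ≤-cong M (λ j _ → *-distribˡ-Σ≤ a (Li⁻ (b ∷ []) j) _) ⟩
  Σ≤ M (λ j → Σ≤ a (λ k → Li⁻ (b ∷ []) j * (c k * (+ j) ^ k)))
    ≡⟨ Σ≤-comm M a _ ⟩
  Σ≤ a (λ k → Σ≤ M (λ j → Li⁻ (b ∷ []) j * (c k * (+ j) ^ k)))
    ≡⟨ Σ≤-cong a (λ k _ → Σ≤-cong M (λ j _ → absorb k j)) ⟩
  Σ≤ a (λ k → Σ≤ M (λ j → c k * Li⁻ ((b +ℕ k) ∷ []) j))
    ≡⟨ Σ≤-cong a (λ k _ → *-distribˡ-Σ≤ M (c k) _) ⟨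
  Σ≤ a (λ k → c k * Σ≤ M (Li⁻ ((b +ℕ k) ∷ [])))
    ≡⟨ Σ≤-cong a (λ k _ → ℤ.*-assoc (-1ℤ ^ k * + (a C k)) (X ^ (a ∸ k)) _) ⟩
  Σ≤ a (λ k → -1ℤ ^ k * + (a C k) * (X ^ (a ∸ k) * Σ≤ M (Li⁻ ((b +ℕ k) ∷ []))))
    ≡⟨ Σ≤-cong a (λ k _ → cong (-1ℤ ^ k * + (a C k) *_) (Li⁻-y-suc (a ∸ k) (b +ℕ k) M)) ⟨
  Σ≤ a (λ k → -1ℤ ^ k * + (a C k) * Li⁻ (y (a ∸ k) (b +ℕ k)) (suc M)) ∎
  where
  X : ℤ
  X = + suc M
  c : ℕ → ℤ
  c k = -1ℤ ^ k * + (a C k) * X ^ (a ∸ k)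
  absorb : ∀ k j → Li⁻ (b ∷ []) j * (c k * (+ j) ^ k) ≡ c k * Li⁻ ((b +ℕ k) ∷ []) j
  absorb k j = trans (x∙yz≈y∙xz (Li⁻ (b ∷ []) j) (c k) ((+ j) ^ k))
                     (cong (c k *_) (sym (Li⁻-[s+k] b k j)))

corollary4p6 : (m n : ℕ) → (N : ℕ) →
    ((Li⁻ (m ∷ []) ⋆ Li⁻ (n ∷ [])) N
      ≡ Σ≤ m (λ k → (-1ℤ ^ k) * (+ (m C k)) * Li⁻ (y (m ∸ k) (n +ℕ k)) N))
    × ((Li⁻ (m ∷ []) ⋆ Li⁻ (n ∷ [])) N
      ≡ Σ≤ n (λ k → (-1ℤ ^ k) * (+ (n C k)) * Li⁻ (y (n ∸ k) (m +ℕ k)) N))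
corollary4p6 m n N =
  trans (⋆-comm (Li⁻ (m ∷ [])) (Li⁻ (n ∷ [])) N) (Li⁻[b]⋆Li⁻[a]-expansion m n N) ,
  Li⁻[b]⋆Li⁻[a]-expansion n m N
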